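{- For every label $X$ and all formulas $\theta,\varphi,\psi$, the sequent $$X:\neg\theta\to(\varphi\veebar\psi)\Rightarrow X:(\neg\theta\to\varphi)\veebar(\neg\theta\to\psi)$$ is derivable in $\mathbf{G}(\mathsf{FBInqBQ})$.
   Context: Language: countably infinite set of variables, countably infinite set of predicate symbols with arities (no identity, constants, function symbols). Formulas: $\varphi ::= P(x_1,\dots,x_m)\mid \bot\mid \varphi\to\varphi\mid\varphi\wedge\varphi\mid \varphi\veebar\varphi\mid \forall x\varphi\mid \bar\exists x\varphi$ ($\veebar$ inquisitive disjunction, $\bar\exists$ inquisitive existential); $\neg\varphi:=\varphi\to\bot$. $\varphi[z/x]$ is capture-avoiding substitution. Calculus $\mathbf{G}(\mathsf{FBInqBQ})$: a label is a nonempty finite subset of $\omega$; a labelled formula is $X:\varphi$ with $X$ a label; a sequent $\Gamma\Rightarrow\Delta$ is a pair of finite multisets of labelled formulas. $X,Y$ range over labels. Initial sequents: $(\mathtt{id})$ $X:P(\bar x),\Gamma\Rightarrow\Delta,Y:P(\bar x)$ whenever $X\supseteq Y$; $(\bot\Rightarrow)$ $X:\bot,\Gamma\Rightarrow\Delta$. Rules (premises / conclusion): $(\Rightarrow\mathtt{at})$: $\Gamma\Rightarrow\Delta,\{k\}:P(\bar x)$ for every $k\in X$ / $\Gamma\Rightarrow\Delta,X:P(\bar x)$. $(\Rightarrow\wedge)$: $\Gamma\Rightarrow\Delta,X:\varphi$ and $\Gamma\Rightarrow\Delta,X:\psi$ / $\Gamma\Rightarrow\Delta,X:\varphi\wedge\psi$.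 $(\wedge\Rightarrow)$: $X:\varphi,X:\psi,\Gamma\Rightarrow\Delta$ / $X:\varphi\wedge\psi,\Gamma\Rightarrow\Delta$. $(\Rightarrow\veebar)$: $\Gamma\Rightarrow\Delta,X:\varphi,X:\psi$ / $\Gamma\Rightarrow\Delta,X:\varphi\veebar\psi$. $(\veebar\Rightarrow)$: $X:\varphi,\Gamma\Rightarrow\Delta$ and $X:\psi,\Gamma\Rightarrow\Delta$ / $X:\varphi\veebar\psi,\Gamma\Rightarrow\Delta$. $(\Rightarrow\to)$: $Y:\varphi,\Gamma\Rightarrow\Delta,Y:\psi$ for every label $Y\subseteq X$ / $\Gamma\Rightarrow\Delta,X:\varphi\to\psi$. $(\to\Rightarrow)$, for a label $Y\subseteq X$: $X:\varphi\to\psi,\Gamma\Rightarrow\Delta,Y:\varphi$ and $Y:\psi,X:\varphi\to\psi,\Gamma\Rightarrow\Delta$ / $X:\varphi\to\psi,\Gamma\Rightarrow\Delta$. $(\Rightarrow\forall)$: $\Gamma\Rightarrow\Delta,X:\varphi[z/x]$ / $\Gamma\Rightarrow\Delta,X:\forall x\varphi$, with $z$ not occurring in the conclusion. $(\forall\Rightarrow)$: $X:\varphi[y/x],X:\forall x\varphi,\Gamma\Rightarrow\Delta$ / $X:\forall x\varphi,\Gamma\Rightarrow\Delta$ ($y$ arbitrary). $(\Rightarrow\bar\exists)$: $\Gamma\Rightarrow\Delta,X:\bar\exists x\varphi,X:\varphi[y/x]$ / $\Gamma\Rightarrow\Delta,X:\bar\exists x\varphi$ ($y$ arbitrary). $(\bar\exists\Rightarrow)$: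 $X:\varphi[z/x],\Gamma\Rightarrow\Delta$ / $X:\bar\exists x\varphi,\Gamma\Rightarrow\Delta$, with $z$ not occurring in the conclusion. A derivation is a finite tree of sequents built from initial sequents by these rules; a sequent is derivable if it is the root of a derivation. -}

module Defs where

open import Data.Nat using (ℕ; suc; _<_; _⊔_; _≟_)
open import Data.Bool using (if_then_else_)
open import Data.List using (List; []; _∷_; _++_; foldr; filter; concat; concatMap)
import Data.List as L
open import Data.Vec using (Vec)
import Data.Vec as V
open import Data.Product using (_×_; _,_)
open import Data.List.Membership.Propositional using (_∈_; _∉_)
open import Data.List.Membership.DecPropositional _≟_ using (_∈?_)
open import Data.List.Relation.Unary.Linked using (Linked; [-])
open import Data.List.Relation.Binary.Permutation.Propositional using (_↭_)
open import Relation.Nullary using (¬?)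
open import Relation.Nullary.Decidable using (does)

-- Syntax. Variables are natural numbers; a predicate symbol is a pair
-- (name p, arity n), so there are countably many of every arity.

Var : Set
Var = ℕ

infixr 6 _∧_
infixr 5 _⩖_
infixr 4 _⊃_

data Formula : Set where
  atom : (p n : ℕ) → Vec Var n → Formula
  ⊥'   : Formula
  _⊃_  : Formula → Formula → Formula
  _∧_  : Formula → Formula → Formula
  _⩖_  : Formula → Formula → Formula        -- inquisitive disjunction ⊻
  all  : Var → Formula → Formula
  ex   : Var → Formula → Formula            -- inquisitive existential ∃̄ x φ

¬' : Formula → Formula
¬' φ = φ ⊃ ⊥'

fv : Formula → List Var
fv (atom p n xs) = V.toList xs
fv ⊥' = []
fv (φ ⊃ ψ) = fv φ ++ fv ψ
fv (φ ∧ ψ) = fv φ ++ fv ψ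
fv (φ ⩖ ψ) = fv φ ++ fv ψ
fv (all x φ) = filter (λ v → ¬? (v ≟ x)) (fv φ)
fv (ex x φ) = filter (λ v → ¬? (v ≟ x)) (fv φ)

vars : Formula → List Var
vars (atom p n xs) = V.toList xs
vars ⊥' = []
vars (φ ⊃ ψ) = vars φ ++ vars ψ
vars (φ ∧ ψ) = vars φ ++ vars ψ
vars (φ ⩖ ψ) = vars φ ++ vars ψ
vars (all x φ) = x ∷ vars φ
vars (ex x φ) = x ∷ vars φ

maxL : List ℕ → ℕ
maxL = foldr _⊔_ 0

update : (Var → Var) → Var → Var → (Var → Var)
update σ y y' v = if does (v ≟ y) then y' else σ v

-- new name for a bound variable y under renaming σ of the free
-- variables fs of the binder: keep y unless it would capture
fresh : (Var → Var) → List Var → Var → Var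
fresh σ fs y = if does (y ∈? L.map σ fs) then suc (maxL (L.map σ fs)) else y

rename : (Var → Var) → Formula → Formula
rename σ (atom p n xs) = atom p n (V.map σ xs)
rename σ ⊥' = ⊥'
rename σ (φ ⊃ ψ) = rename σ φ ⊃ rename σ ψ
rename σ (φ ∧ ψ) = rename σ φ ∧ rename σ ψ
rename σ (φ ⩖ ψ) = rename σ φ ⩖ rename σ ψ
rename σ (all y φ) =
  let y' = fresh σ (fv (all y φ)) y in all y' (rename (update σ y y') φ)
rename σ (ex y φ) =
  let y' = fresh σ (fv (ex y φ)) y in ex y' (rename (update σ y y') φ)

_[_/_] : Formula → Var → Var → Formula
φ [ z / x ] = rename (λ v → if does (v ≟ x) then z else v) φ

-- Labels: nonempty finite subsets of ω, in canonical form as a strictly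
-- increasing nonempty list (so equal sets are equal labels).

record Label : Set where
  constructor label
  field
    least  : ℕ
    rest   : List ℕ
    sorted : Linked _<_ (least ∷ rest)

elems : Label → List ℕ
elems X = Label.least X ∷ Label.rest X

_∈ₗ_ : ℕ → Label → Set
k ∈ₗ X = k ∈ elems X

_⊆ₗ_ : Label → Label → Set
Y ⊆ₗ X = ∀ k → k ∈ₗ Y → k ∈ₗ X

singleton : ℕ → Label
singleton k = label k [] [-]

LFormula : Set
LFormula = Label × Formula

Ctx : Set
Ctx = List LFormula

varsCtx : Ctx → List Var
varsCtx = concatMap (λ { (X , φ) → vars φ })

-- The calculus G(FBInqBQ).  A sequent Γ ⇒ Δ is a pair of finite
-- multisets, represented as lists taken up to permutation (rule ex).
-- Γ ⊢ Δ means "the sequent Γ ⇒ Δ is derivable".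

infix 2 _⊢_

data _⊢_ : Ctx → Ctx → Set where
  ex-perm : ∀ {Γ Γ' Δ Δ'} → Γ ↭ Γ' → Δ ↭ Δ' → Γ ⊢ Δ → Γ' ⊢ Δ'
  idax : ∀ {X Y p n xs Γ Δ} → Y ⊆ₗ X →
         ((X , atom p n xs) ∷ Γ) ⊢ ((Y , atom p n xs) ∷ Δ)
  ⊥L   : ∀ {X Γ Δ} → ((X , ⊥') ∷ Γ) ⊢ Δ
  atR  : ∀ {X p n xs Γ Δ} →
         (∀ k → k ∈ₗ X → Γ ⊢ ((singleton k , atom p n xs) ∷ Δ)) →
         Γ ⊢ ((X , atom p n xs) ∷ Δ)
  ∧R   : ∀ {X φ ψ Γ Δ} → Γ ⊢ ((X , φ) ∷ Δ) → Γ ⊢ ((X , ψ) ∷ Δ) →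
         Γ ⊢ ((X , φ ∧ ψ) ∷ Δ)
  ∧L   : ∀ {X φ ψ Γ Δ} → ((X , φ) ∷ (X , ψ) ∷ Γ) ⊢ Δ →
         ((X , φ ∧ ψ) ∷ Γ) ⊢ Δ
  ⩖R   : ∀ {X φ ψ Γ Δ} → Γ ⊢ ((X , φ) ∷ (X , ψ) ∷ Δ) →
         Γ ⊢ ((X , φ ⩖ ψ) ∷ Δ)
  ⩖L   : ∀ {X φ ψ Γ Δ} → ((X , φ) ∷ Γ) ⊢ Δ → ((X , ψ) ∷ Γ) ⊢ Δ →
         ((X , φ ⩖ ψ) ∷ Γ) ⊢ Δ
  ⊃R   : ∀ {X φ ψ Γ Δ} →
         (∀ Y → Y ⊆ₗ X → ((Y , φ) ∷ Γ) ⊢ ((Y , ψ) ∷ Δ)) →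
         Γ ⊢ ((X , φ ⊃ ψ) ∷ Δ)
  ⊃L   : ∀ {X Y φ ψ Γ Δ} → Y ⊆ₗ X →
         ((X , φ ⊃ ψ) ∷ Γ) ⊢ ((Y , φ) ∷ Δ) →
         ((Y , ψ) ∷ (X , φ ⊃ ψ) ∷ Γ) ⊢ Δ →
         ((X , φ ⊃ ψ) ∷ Γ) ⊢ Δ
  ∀R   : ∀ {X x z φ Γ Δ} →
         z ∉ varsCtx Γ ++ varsCtx ((X , all x φ) ∷ Δ) →
         Γ ⊢ ((X , φ [ z / x ]) ∷ Δ) →
         Γ ⊢ ((X , all x φ) ∷ Δ)
  ∀L   : ∀ {X x φ Γ Δ} (y : Var) →
         ((X , φ [ y / x ]) ∷ (X , all x φ) ∷ Γ) ⊢ Δ →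
         ((X , all x φ) ∷ Γ) ⊢ Δ
  ∃R   : ∀ {X x φ Γ Δ} (y : Var) →
         Γ ⊢ ((X , ex x φ) ∷ (X , φ [ y / x ]) ∷ Δ) →
         Γ ⊢ ((X , ex x φ) ∷ Δ)
  ∃L   : ∀ {X x z φ Γ Δ} →
         z ∉ varsCtx ((X , ex x φ) ∷ Γ) ++ varsCtx Δ →
         ((X , φ [ z / x ]) ∷ Γ) ⊢ Δ →
         ((X , ex x φ) ∷ Γ) ⊢ Δ

{-# OPTIONS --safe #-}
module Submission where

-- Negations are flat: if Z and Z' both support ¬θ, so does Z ∪ Z', because
-- every V ⊆ Z ∪ Z' supporting θ has a point k in Z or in Z', and θ at {k} ⊆ V
-- contradicts ¬θ there.  So for Z, Z' ⊆ X supporting ¬θ, the hypothesis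
-- ¬θ → (φ ⊻ ψ) at X can be applied at Z ∪ Z' ⊆ X, and persistence takes
-- φ ⊻ ψ at Z ∪ Z' to φ at Z or to ψ at Z'.

open import Defs
open import Data.List using (List; []; _∷_; _++_; filter)
open import Data.List.Membership.Propositional using (_∈_; _∉_)
open import Data.List.Membership.Propositional.Properties using (∈-filter⁺; ∈-filter⁻)
open import Data.List.Relation.Unary.Any using (here; there)
open import Data.List.Relation.Unary.Linked using (Linked)
open import Data.List.Relation.Unary.Linked.Properties using (filter⁺)
open import Data.List.Relation.Binary.Permutation.Propositional using (_↭_; ↭-refl; ↭-prep; ↭-swap; ↭-trans)
open import Data.Nat using (ℕ; suc; _≤_; _<_; _+_; s≤s; _≟_)
open import Data.List.Membership.DecPropositional _≟_ using (_∈?_)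
open import Data.Nat.Properties using (≤-refl; ≤-trans; <-trans; n≮n; m≤m⊔n; m≤n⊔m; m≤m+n; m≤n+m)
open import Data.Product using (_×_; _,_; proj₁; proj₂)
open import Data.Sum using (_⊎_; inj₁; inj₂)
open import Relation.Binary.PropositionalEquality using (_≡_; refl; sym; cong; cong₂; subst)
open import Relation.Nullary.Decidable using (_⊎-dec_)
open import Level using (0ℓ)
open import Relation.Unary using (Pred; Decidable)

private
  variable
    A B C : LFormula
    Γ Γ' Δ : Ctx
    X Y Z Z' V : Label
    k : ℕ
    θ : Formula

∈⇒≤maxL : ∀ {n} ns → n ∈ ns → n ≤ maxL ns
∈⇒≤maxL (n ∷ ns) (here refl) = m≤m⊔n n (maxL ns)
∈⇒≤maxL (n ∷ ns) (there n∈ns) = ≤-trans (∈⇒≤maxL ns n∈ns) (m≤n⊔m n (maxL ns))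

suc-maxL-∉ : ∀ ns → suc (maxL ns) ∉ ns
suc-maxL-∉ ns p = n≮n _ (∈⇒≤maxL ns p)

size : Formula → ℕ
size (atom p n xs) = 1
size ⊥' = 1
size (φ ⊃ ψ) = suc (size φ + size ψ)
size (φ ∧ ψ) = suc (size φ + size ψ)
size (φ ⩖ ψ) = suc (size φ + size ψ)
size (all x φ) = suc (size φ)
size (ex x φ) = suc (size φ)

size-rename : ∀ σ φ → size (rename σ φ) ≡ size φ
size-rename σ (atom p n xs) = refl
size-rename σ ⊥' = refl
size-rename σ (φ ⊃ ψ) = cong₂ (λ a b → suc (a + b)) (size-rename σ φ) (size-rename σ ψ)
size-rename σ (φ ∧ ψ) = cong₂ (λ a b → suc (a + b)) (size-rename σ φ) (size-rename σ ψ)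
size-rename σ (φ ⩖ ψ) = cong₂ (λ a b → suc (a + b)) (size-rename σ φ) (size-rename σ ψ)
size-rename σ (all y φ) = cong suc (size-rename _ φ)
size-rename σ (ex y φ) = cong suc (size-rename _ φ)

⊆ₗ-refl : ∀ {X} → X ⊆ₗ X
⊆ₗ-refl k k∈X = k∈X

⊆ₗ-trans : ∀ {Z Y X} → Z ⊆ₗ Y → Y ⊆ₗ X → Z ⊆ₗ X
⊆ₗ-trans Z⊆Y Y⊆X k k∈Z = Y⊆X k (Z⊆Y k k∈Z)

singleton-⊆ₗ : k ∈ₗ X → singleton k ⊆ₗ X
singleton-⊆ₗ k∈X _ (here refl) = k∈X

exchangeˡ : Γ ↭ Γ' → Γ ⊢ Δ → Γ' ⊢ Δ
exchangeˡ p = ex-perm p ↭-refl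

swapˡ : (A ∷ B ∷ Γ) ⊢ Δ → (B ∷ A ∷ Γ) ⊢ Δ
swapˡ = exchangeˡ (↭-swap _ _ ↭-refl)

swapʳ : Γ ⊢ (A ∷ B ∷ Δ) → Γ ⊢ (B ∷ A ∷ Δ)
swapʳ = ex-perm ↭-refl (↭-swap _ _ ↭-refl)

rotateˡ : (A ∷ B ∷ C ∷ Γ) ⊢ Δ → (B ∷ C ∷ A ∷ Γ) ⊢ Δ
rotateˡ = exchangeˡ (↭-trans (↭-swap _ _ ↭-refl) (↭-prep _ (↭-swap _ _ ↭-refl)))

rotateʳ : (B ∷ C ∷ A ∷ Γ) ⊢ Δ → (A ∷ B ∷ C ∷ Γ) ⊢ Δ
rotateʳ = exchangeˡ (↭-trans (↭-prep _ (↭-swap _ _ ↭-refl)) (↭-swap _ _ ↭-refl))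

-- Induction on size rather than on φ: the quantifier cases recurse on
-- φ [ z / x ], which is not a subformula.
identity-≤ : ∀ n φ → size φ ≤ n → ∀ {X Y Γ Δ} → Y ⊆ₗ X → ((X , φ) ∷ Γ) ⊢ ((Y , φ) ∷ Δ)
identity-≤ n (atom p m xs) _ Y⊆X = idax Y⊆X
identity-≤ n ⊥' _ Y⊆X = ⊥L
identity-≤ (suc n) (φ ⊃ ψ) (s≤s s) {X} {Y} Y⊆X =
  ⊃R λ Z Z⊆Y → swapˡ
    (⊃L {Y = Z} (⊆ₗ-trans {Z} {Y} {X} Z⊆Y Y⊆X)
      (swapˡ (identity-≤ n φ (≤-trans (m≤m+n _ _) s) (⊆ₗ-refl {Z})))
      (identity-≤ n ψ (≤-trans (m≤n+m _ _) s) (⊆ₗ-refl {Z})))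
identity-≤ (suc n) (φ ∧ ψ) (s≤s s) Y⊆X =
  ∧L (∧R (identity-≤ n φ (≤-trans (m≤m+n _ _) s) Y⊆X)
         (swapˡ (identity-≤ n ψ (≤-trans (m≤n+m _ _) s) Y⊆X)))
identity-≤ (suc n) (φ ⩖ ψ) (s≤s s) Y⊆X =
  ⩖R (⩖L (identity-≤ n φ (≤-trans (m≤m+n _ _) s) Y⊆X)
         (swapʳ (identity-≤ n ψ (≤-trans (m≤n+m _ _) s) Y⊆X)))
identity-≤ (suc n) (all x φ) (s≤s s) {X} {Y} {Γ} {Δ} Y⊆X =
  ∀R (suc-maxL-∉ used) (∀L z (identity-≤ n (φ [ z / x ]) size-φ[z/x]≤n Y⊆X))
  where
    used = varsCtx ((X , all x φ) ∷ Γ) ++ varsCtx ((Y , all x φ) ∷ Δ)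
    z = suc (maxL used)
    size-φ[z/x]≤n = subst (_≤ n) (sym (size-rename _ φ)) s
identity-≤ (suc n) (ex x φ) (s≤s s) {X} {Y} {Γ} {Δ} Y⊆X =
  ∃L (suc-maxL-∉ used) (∃R z (swapʳ (identity-≤ n (φ [ z / x ]) size-φ[z/x]≤n Y⊆X)))
  where
    used = varsCtx ((X , ex x φ) ∷ Γ) ++ varsCtx ((Y , ex x φ) ∷ Δ)
    z = suc (maxL used)
    size-φ[z/x]≤n = subst (_≤ n) (sym (size-rename _ φ)) s

identity : ∀ φ → Y ⊆ₗ X → ((X , φ) ∷ Γ) ⊢ ((Y , φ) ∷ Δ)
identity φ = identity-≤ (size φ) φ ≤-refl

toLabel : (ks : List ℕ) → Linked _<_ ks → k ∈ ks → Label
toLabel (k ∷ ks) sorted _ = label k ks sorted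

elems-toLabel : ∀ ks sorted (k∈ks : k ∈ ks) → elems (toLabel ks sorted k∈ks) ≡ ks
elems-toLabel (k ∷ ks) sorted _ = refl

module Filterₗ {P : Pred ℕ 0ℓ} (P? : Decidable P) (X : Label) (k∈X : k ∈ₗ X) (Pk : P k) where

  private
    ks = filter P? (elems X)
    k∈ks = ∈-filter⁺ P? k∈X Pk

  filterₗ : Label
  filterₗ = toLabel ks (filter⁺ P? <-trans (Label.sorted X)) k∈ks

  ∈-filterₗ⁻ : ∀ {n} → n ∈ₗ filterₗ → n ∈ₗ X × P n
  ∈-filterₗ⁻ n∈ = ∈-filter⁻ P? {xs = elems X} (subst (_ ∈_) (elems-toLabel ks _ k∈ks) n∈)

  ∈-filterₗ⁺ : ∀ {n} → n ∈ₗ X → P n → n ∈ₗ filterₗ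
  ∈-filterₗ⁺ n∈X Pn = subst (_ ∈_) (sym (elems-toLabel ks _ k∈ks)) (∈-filter⁺ P? n∈X Pn)

-- Z ∪ Z' is cut out of an ambient label X by filtering, which keeps it sorted.
module Union {X : Label} (Z Z' : Label) (Z⊆X : Z ⊆ₗ X) (Z'⊆X : Z' ⊆ₗ X) where

  private
    in-Z∪Z'? : Decidable (λ n → n ∈ₗ Z ⊎ n ∈ₗ Z')
    in-Z∪Z'? n = (n ∈? elems Z) ⊎-dec (n ∈? elems Z')

    open Filterₗ in-Z∪Z'? X (Z⊆X _ (here refl)) (inj₁ (here refl))

  Z∪Z' : Label
  Z∪Z' = filterₗ

  Z∪Z'⊆X : Z∪Z' ⊆ₗ X
  Z∪Z'⊆X _ n∈ = proj₁ (∈-filterₗ⁻ n∈)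

  Z∪Z'-covered : ∀ n → n ∈ₗ Z∪Z' → n ∈ₗ Z ⊎ n ∈ₗ Z'
  Z∪Z'-covered _ n∈ = proj₂ (∈-filterₗ⁻ n∈)

  Z⊆Z∪Z' : Z ⊆ₗ Z∪Z'
  Z⊆Z∪Z' _ n∈Z = ∈-filterₗ⁺ (Z⊆X _ n∈Z) (inj₁ n∈Z)

  Z'⊆Z∪Z' : Z' ⊆ₗ Z∪Z'
  Z'⊆Z∪Z' _ n∈Z' = ∈-filterₗ⁺ (Z'⊆X _ n∈Z') (inj₂ n∈Z')

¬-refute : k ∈ₗ Z → k ∈ₗ V → ((Z , ¬' θ) ∷ (V , θ) ∷ Γ) ⊢ Δ
¬-refute {k = k} {Z = Z} {V = V} {θ = θ} k∈Z k∈V =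
  ⊃L {Y = singleton k} (singleton-⊆ₗ {X = Z} k∈Z)
    (swapˡ (identity θ (singleton-⊆ₗ {X = V} k∈V)))
    ⊥L

¬-flat : ∀ W → (∀ n → n ∈ₗ W → n ∈ₗ Z ⊎ n ∈ₗ Z') →
         ((Z' , ¬' θ) ∷ (Z , ¬' θ) ∷ Γ) ⊢ ((W , ¬' θ) ∷ Δ)
¬-flat {Z = Z} {Z' = Z'} {θ = θ} {Γ = Γ} {Δ = Δ} W covered =
  ⊃R λ V V⊆W → refute-at-least V (covered _ (V⊆W _ (here refl)))
  where
    refute-at-least : ∀ V → Label.least V ∈ₗ Z ⊎ Label.least V ∈ₗ Z' →
                      ((V , θ) ∷ (Z' , ¬' θ) ∷ (Z , ¬' θ) ∷ Γ) ⊢ ((V , ⊥') ∷ Δ)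
    refute-at-least V (inj₁ k∈Z) = rotateˡ (¬-refute {Z = Z} k∈Z (here refl))
    refute-at-least V (inj₂ k∈Z') = swapˡ (¬-refute k∈Z' (here refl))

proposition9 : (X : Label) (θ φ ψ : Formula) →
    ((X , ¬' θ ⊃ (φ ⩖ ψ)) ∷ []) ⊢ ((X , (¬' θ ⊃ φ) ⩖ (¬' θ ⊃ ψ)) ∷ [])
proposition9 X θ φ ψ =
  ⩖R (⊃R λ Z Z⊆X → swapʳ (⊃R λ Z' Z'⊆X →
    rotateˡ (⊃L-at-Z∪Z' Z Z' Z⊆X Z'⊆X)))
  where
    ⊃L-at-Z∪Z' : ∀ Z Z' → Z ⊆ₗ X → Z' ⊆ₗ X →
            ((X , ¬' θ ⊃ (φ ⩖ ψ)) ∷ (Z' , ¬' θ) ∷ (Z , ¬' θ) ∷ []) ⊢ ((Z' , ψ) ∷ (Z , φ) ∷ [])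
    ⊃L-at-Z∪Z' Z Z' Z⊆X Z'⊆X =
      ⊃L {Y = Z∪Z'} Z∪Z'⊆X
        (rotateʳ (¬-flat Z∪Z' Z∪Z'-covered))
        (⩖L (swapʳ (identity φ Z⊆Z∪Z')) (identity ψ Z'⊆Z∪Z'))
      where open Union {X} Z Z' Z⊆X Z'⊆X
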